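{- Let $A\in CP_n$ have zero trace, and let $\ell_1<\ell_2<\dots<\ell_z$ be all the distinct lengths of elementary cycles in $D(A)$. Then $\exp(A:1,1)=n+F(\ell_1,\ell_2,\ldots,\ell_z)$.
   Context: For $n \ge 2$, $C_n$ is the set of all $n\times n$ $(0,1)$-matrices $A=(a_{ij})$ with $a_{i,i+1}=1$ for $1\le i\le n-1$, last row arbitrary in $\{0,1\}^n$, and all other entries $0$. These are the $(0,1)$ companion matrices. A nonnegative matrix $A$ is primitive if $A^m$ has all entries positive for some positive integer $m$. $CP_n$ is the set of primitive matrices in $C_n$. $D(A)$ is the digraph on $\{1,\dots,n\}$ with an edge $(i,j)$ iff $a_{ij}=1$. An elementary cycle is a closed walk whose vertices are distinct except that the first equals the last. $\exp(A:i,j)$ is the smallest positive integer $k$ such that $(A^l)_{ij}>0$ for every integer $l\ge k$. For relatively prime positive integers $a_1,\dots,a_u$, $F(a_1,\dots,a_u)$ denotes the smallest integer $N$ such that $N$ and every integer larger than $N$ can be written as $n_1a_1+\dots+n_ua_u$ with nonnegative integers $n_r$. -}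

module Defs where

open import Data.Nat using (ℕ; zero; suc; _+_; _*_; _≤_; _<_; z≤n; s≤s; _≟_)
open import Relation.Nullary using (yes; no)
open import Data.Nat.DivMod using (_mod_)
open import Data.Fin using (Fin; toℕ) renaming (zero to fzero; suc to fsuc)
open import Data.Product using (Σ; ∃; _×_; _,_)
open import Data.Sum using (_⊎_)
open import Data.List using (List; []; _∷_)
open import Relation.Binary.PropositionalEquality using (_≡_; _≢_)
open import Function.Definitions using (Injective)

-- n × n matrices with natural-number entries (rows/columns indexed 0..n-1,
-- so paper index i corresponds to Fin element i-1).
Matrix : ℕ → Set
Matrix n = Fin n → Fin n → ℕ

sumFin : ∀ {n} → (Fin n → ℕ) → ℕ
sumFin {zero}  f = 0
sumFin {suc n} f = f fzero + sumFin (λ i → f (fsuc i))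

identity : ∀ {n} → Matrix n
identity i j with toℕ i ≟ toℕ j
... | yes _ = 1
... | no  _ = 0

_⊗_ : ∀ {n} → Matrix n → Matrix n → Matrix n
(A ⊗ B) i j = sumFin (λ k → A i k * B k j)

pow : ∀ {n} → Matrix n → ℕ → Matrix n
pow A zero    = identity
pow A (suc m) = pow A m ⊗ A

trace : ∀ {n} → Matrix n → ℕ
trace A = sumFin (λ i → A i i)

IsCompanion : ∀ {n} → Matrix n → Set
IsCompanion {n} A = ∀ i j →
    (toℕ j ≡ suc (toℕ i) → A i j ≡ 1)
  × (suc (toℕ i) ≡ n → (A i j ≡ 0 ⊎ A i j ≡ 1))
  × (toℕ j ≢ suc (toℕ i) → suc (toℕ i) ≢ n → A i j ≡ 0)

IsPrimitive : ∀ {n} → Matrix n → Set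
IsPrimitive A = Σ ℕ λ m → 1 ≤ m × (∀ i j → 0 < pow A m i j)

Edge : ∀ {n} → Matrix n → Fin n → Fin n → Set
Edge A i j = A i j ≡ 1

next : ∀ {k} → Fin (suc k) → Fin (suc k)
next {k} i = suc (toℕ i) mod (suc k)

HasElemCycleOfLength : ∀ {n} → Matrix n → ℕ → Set
HasElemCycleOfLength {n} A ℓ =
  Σ ℕ λ k → ℓ ≡ suc k ×
    Σ (Fin (suc k) → Fin n) λ v → Injective _≡_ _≡_ v × (∀ i → Edge A (v i) (v (next i)))

IsLocalExp : ∀ {n} → Matrix n → Fin n → Fin n → ℕ → Set
IsLocalExp A i j k =
    1 ≤ k × (∀ l → k ≤ l → 0 < pow A l i j)
  × (∀ k′ → 1 ≤ k′ → (∀ l → k′ ≤ l → 0 < pow A l i j) → k ≤ k′)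

Representable : List ℕ → ℕ → Set
Representable []       m = m ≡ 0
Representable (a ∷ as) m = Σ ℕ λ c → Σ ℕ λ r → m ≡ c * a + r × Representable as r

IsFrobeniusF : List ℕ → ℕ → Set
IsFrobeniusF as N =
    (∀ m → N ≤ m → Representable as m)
  × (∀ M → (∀ m → M ≤ m → Representable as m) → N ≤ M)

vertex1 : ∀ {n} → 2 ≤ n → Fin n
vertex1 {suc n} _ = fzero

module Submission where

-- Vertices of D(A) are numbered 0,…,n-1 (the paper's vertex i is our i-1), so for
-- A ∈ C_n the edges are the path edges j → j+1 and the back edges last → b, one for
-- each b with A last b = 1, where last = n-1.  The proof has three parts.
--   * Cycles.  Every elementary cycle enters the path by some back edge last → b and
--     climbs b → … → last, so the cycle lengths are exactly the back lengths n - b.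
--   * Closed walks at 0.  A walk from 0 of length l ≥ 1 back to 0 must end with the
--     back edge last → 0, and apart from the straight path 0 → … → last → 0 it
--     consists of loops at last, each of a back length.  Hence A^l_00 > 0 with l ≥ 1
--     iff l = n + x with x a sum of cycle lengths, i.e. x representable by ℓ_1,…,ℓ_z.
--   * Thresholds.  Primitivity makes all long closed walks at 0 exist, so some least
--     threshold F of representability exists (representability is decidable, being
--     equivalent to positivity of a matrix entry), and exp(A:1,1) = n + F.

open import Defs
open import Data.Nat using (ℕ; _+_; _≤_; _<_)
open import Data.Product using (Σ; _×_)
open import Data.List using (List)
open import Data.List.Membership.Propositional using (_∈_)
open import Data.List.Relation.Unary.Linked using (Linked)
open import Function.Bundles using (_⇔_)
open import Relation.Binary.PropositionalEquality using (_≡_)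

open import Data.Nat using (zero; suc; _*_; _∸_; _%_; z≤n; s≤s; _≟_; _<?_; NonZero)
open import Data.Nat.Properties
open import Data.Nat.DivMod
  using (%-distribˡ-+; m%n%n≡m%n; [m+n]%n≡m%n; m≤n⇒[n∸m]%m≡n%m; m<n⇒m%n≡m; n%n≡0; m%n<n)
open import Data.Fin using (Fin; toℕ; fromℕ; fromℕ<; inject₁) renaming (zero to fzero; suc to fsuc)
open import Data.Fin.Properties using (toℕ-injective; toℕ-fromℕ; toℕ-fromℕ<; toℕ-inject₁; toℕ<n; toℕ≤pred[n])
open import Data.Product using (_,_; proj₁; proj₂)
open import Data.Sum using (_⊎_; inj₁; inj₂)
open import Data.Empty using (⊥-elim)
open import Data.List using ([]; _∷_)
open import Data.List.Relation.Unary.Any using (here; there)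
open import Relation.Nullary using (¬_; Dec; yes; no)
open import Relation.Nullary.Decidable using (map′)
open import Relation.Binary.PropositionalEquality using (refl; sym; trans; cong; subst; subst₂; module ≡-Reasoning)
open import Function.Bundles using (Equivalence; mk⇔)
open import Function.Construct.Composition using (_⇔-∘_)
open import Function.Construct.Symmetry using (⇔-sym)
open import Function.Definitions using (Injective)

open ≡-Reasoning

*-pos : ∀ {a b} → 0 < a → 0 < b → 0 < a * b
*-pos {suc a} {suc b} _ _ = s≤s z≤n

*-pos⁻ : ∀ a b → 0 < a * b → 0 < a × 0 < b
*-pos⁻ (suc a) (suc b) _ = s≤s z≤n , s≤s z≤n
*-pos⁻ (suc a) zero    p = ⊥-elim (<-irrefl (sym (*-zeroʳ a)) p)

sumFin-pos : ∀ {n} (f : Fin n → ℕ) k → 0 < f k → 0 < sumFin f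
sumFin-pos f fzero    p = ≤-trans p (m≤m+n _ _)
sumFin-pos f (fsuc k) p = ≤-trans (sumFin-pos (λ i → f (fsuc i)) k p) (m≤n+m _ _)

sumFin-pos⁻ : ∀ {n} (f : Fin n → ℕ) → 0 < sumFin f → Σ (Fin n) λ k → 0 < f k
sumFin-pos⁻ {suc n} f p with f fzero in eq
... | suc _ = fzero , subst (0 <_) (sym eq) (s≤s z≤n)
... | zero with sumFin-pos⁻ (λ i → f (fsuc i)) p
...   | k , q = fsuc k , q

-- Walks: (A^l)_ij > 0 iff D⁺(A), the digraph of positive entries, has a walk of
-- length l from i to j.  Walk wraps this positivity in a record so that A, l, i and
-- j can be recovered by type inference.

record Walk {n} (A : Matrix n) (l : ℕ) (i j : Fin n) : Set where
  constructor walk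
  field positive : 0 < pow A l i j

walk⇔positive : ∀ {n} {A : Matrix n} {l i j} → Walk A l i j ⇔ 0 < pow A l i j
walk⇔positive = mk⇔ Walk.positive walk

edge-pos : ∀ {n} (A : Matrix n) {i j} → Edge A i j → 0 < A i j
edge-pos A e = subst (0 <_) (sym e) (s≤s z≤n)

walk-nil : ∀ {n} {A : Matrix n} {i} → Walk A 0 i i
walk-nil {i = i} = walk (diagonal i)
  where
  diagonal : ∀ {n} (i : Fin n) → 0 < identity i i
  diagonal i with toℕ i ≟ toℕ i
  ... | yes _ = s≤s z≤n
  ... | no i≢i = ⊥-elim (i≢i refl)

walk-nil⁻ : ∀ {n} {A : Matrix n} {i j} → Walk A 0 i j → toℕ i ≡ toℕ j
walk-nil⁻ {i = i} {j} (walk w) with toℕ i ≟ toℕ j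
... | yes i≡j = i≡j
... | no _ = ⊥-elim (<-irrefl refl w)

walk-snoc : ∀ {n} {A : Matrix n} {l i k j} → Walk A l i k → 0 < A k j → Walk A (suc l) i j
walk-snoc {A = A} {l} {i} {k} {j} (walk w) e =
  walk (sumFin-pos (λ k′ → pow A l i k′ * A k′ j) k (*-pos w e))

walk-unsnoc : ∀ {n} {A : Matrix n} {l i j} → Walk A (suc l) i j →
  Σ (Fin n) λ k → Walk A l i k × 0 < A k j
walk-unsnoc {A = A} {l} {i} {j} (walk w) with sumFin-pos⁻ (λ k → pow A l i k * A k j) w
... | k , p with *-pos⁻ (pow A l i k) (A k j) p
...   | i→k , k→j = k , walk i→k , k→j

-- If every vertex has an in-neighbour, an entirely positive row of A^m stays entirely
-- positive in every higher power; this turns primitivity into "all long walks exist".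
positive-row-persists : ∀ {n} {A : Matrix n} {m i} → (∀ j → Σ (Fin n) λ k → 0 < A k j) →
  (∀ j → Walk A m i j) → ∀ l → m ≤ l → ∀ j → Walk A l i j
positive-row-persists {A = A} {m} {i} entered row l m≤l =
  subst (λ t → ∀ j → Walk A t i j) (m+[n∸m]≡n m≤l) (extend (l ∸ m))
  where
  extend : ∀ d j → Walk A (m + d) i j
  extend zero    = subst (λ t → ∀ j → Walk A t i j) (sym (+-identityʳ m)) row
  extend (suc d) j = subst (λ t → Walk A t i j) (sym (+-suc m d))
    (walk-snoc (extend d (proj₁ (entered j))) (proj₂ (entered j)))

-- Finite sums of numbers with a property P; for P = (_∈ ls) these are exactly the
-- numbers representable by ls.

data SumOf (P : ℕ → Set) : ℕ → Set where
  nil  : SumOf P 0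
  cons : ∀ {s m} → P s → SumOf P m → SumOf P (s + m)

sumOf-map : ∀ {P Q : ℕ → Set} → (∀ {s} → P s → Q s) → ∀ {m} → SumOf P m → SumOf Q m
sumOf-map f nil        = nil
sumOf-map f (cons p S) = cons (f p) (sumOf-map f S)

sumOf-⇔ : ∀ {P Q : ℕ → Set} → (∀ s → P s ⇔ Q s) → ∀ {m} → SumOf P m ⇔ SumOf Q m
sumOf-⇔ P⇔Q = mk⇔ (sumOf-map (Equivalence.to (P⇔Q _))) (sumOf-map (Equivalence.from (P⇔Q _)))

sumOf-+ : ∀ {P : ℕ → Set} {x y} → SumOf P x → SumOf P y → SumOf P (x + y)
sumOf-+ nil T = T
sumOf-+ {P} {y = y} (cons {s} {m} p S) T = subst (SumOf P) (sym (+-assoc s m y)) (cons p (sumOf-+ S T))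

sumOf-* : ∀ {P : ℕ → Set} {a} → P a → ∀ c → SumOf P (c * a)
sumOf-* p zero    = nil
sumOf-* p (suc c) = cons p (sumOf-* p c)

representable-zero : ∀ ls → Representable ls 0
representable-zero []       = refl
representable-zero (a ∷ as) = 0 , 0 , refl , representable-zero as

representable-+ : ∀ ls {a m} → a ∈ ls → Representable ls m → Representable ls (a + m)
representable-+ (a ∷ as) (here refl) (c , r , refl , R) = suc c , r , sym (+-assoc a (c * a) r) , R
representable-+ (b ∷ as) {a} (there a∈as) (c , r , refl , R) = c , a + r , reorder , representable-+ as a∈as R
  where
  reorder : a + (c * b + r) ≡ c * b + (a + r)
  reorder = begin
    a + (c * b + r) ≡⟨ sym (+-assoc a (c * b) r) ⟩
    a + c * b + r   ≡⟨ cong (_+ r) (+-comm a (c * b)) ⟩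
    c * b + a + r   ≡⟨ +-assoc (c * b) a r ⟩
    c * b + (a + r) ∎

representable⇔sumOf : ∀ ls {m} → Representable ls m ⇔ SumOf (_∈ ls) m
representable⇔sumOf ls = mk⇔ (to ls) (from ls)
  where
  to : ∀ ls {m} → Representable ls m → SumOf (_∈ ls) m
  to []       refl = nil
  to (a ∷ as) (c , r , refl , R) = sumOf-+ (sumOf-* (here refl) c) (sumOf-map there (to as R))
  from : ∀ ls {m} → SumOf (_∈ ls) m → Representable ls m
  from ls nil        = representable-zero ls
  from ls (cons p S) = representable-+ ls p (from ls S)

IsThreshold : (ℕ → Set) → ℕ → Set
IsThreshold Q N = (∀ x → N ≤ x → Q x) × (∀ M → (∀ x → M ≤ x → Q x) → N ≤ M)

least-threshold : ∀ {Q : ℕ → Set} → (∀ x → Dec (Q x)) → ∀ M → (∀ x → M ≤ x → Q x) →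
  Σ ℕ (IsThreshold Q)
least-threshold Q? zero    always = zero , always , λ _ _ → z≤n
least-threshold {Q} Q? (suc M) always with Q? M
... | yes q = least-threshold Q? M from-M
  where
  from-M : ∀ x → M ≤ x → Q x
  from-M x M≤x with m≤n⇒m<n∨m≡n M≤x
  ... | inj₁ M<x  = always x M<x
  ... | inj₂ refl = q
... | no ¬q = suc M , always , λ M′ from-M′ → ≰⇒> (λ M′≤M → ¬q (from-M′ M M′≤M))

shift-threshold : ∀ {P Q : ℕ → Set} {n N} →
  (∀ l → 1 ≤ l → P l → Σ ℕ λ x → l ≡ n + x) → (∀ x → P (n + x) ⇔ Q x) → IsThreshold Q N →
  (∀ l → n + N ≤ l → P l) × (∀ k → 1 ≤ k → (∀ l → k ≤ l → P l) → n + N ≤ k)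
shift-threshold {P} {n = n} {N} shape P⇔Q (from-N , least) = upper , lower
  where
  upper : ∀ l → n + N ≤ l → P l
  upper l n+N≤l = subst P (m+[n∸m]≡n n≤l) (Equivalence.from (P⇔Q (l ∸ n)) (from-N (l ∸ n) N≤l∸n))
    where
    n≤l : n ≤ l
    n≤l = ≤-trans (m≤m+n n N) n+N≤l
    N≤l∸n : N ≤ l ∸ n
    N≤l∸n = +-cancelˡ-≤ n N (l ∸ n) (subst (n + N ≤_) (sym (m+[n∸m]≡n n≤l)) n+N≤l)
  lower : ∀ k → 1 ≤ k → (∀ l → k ≤ l → P l) → n + N ≤ k
  lower k 1≤k from-k with shape k 1≤k (from-k k ≤-refl)
  ... | y , refl = +-monoʳ-≤ n (least y λ x y≤x → Equivalence.to (P⇔Q x) (from-k (n + x) (+-monoʳ-≤ n y≤x)))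

suc-% : ∀ t d .{{_ : NonZero d}} → suc (t % d) % d ≡ suc t % d
suc-% t d = begin
  (1 + t % d) % d         ≡⟨ %-distribˡ-+ 1 (t % d) d ⟩
  (1 % d + t % d % d) % d ≡⟨ cong (λ r → (1 % d + r) % d) (m%n%n≡m%n t d) ⟩
  (1 % d + t % d) % d     ≡⟨ sym (%-distribˡ-+ 1 t d) ⟩
  (1 + t) % d             ∎

+-%-return : ∀ {r d ℓ} .{{_ : NonZero ℓ}} → r < ℓ → d < ℓ → (r + d) % ℓ ≡ r → d ≡ 0
+-%-return {r} {d} {ℓ} r<ℓ d<ℓ ret with r + d <? ℓ
... | yes r+d<ℓ = +-cancelˡ-≡ r d 0 (trans (trans (sym (m<n⇒m%n≡m r+d<ℓ)) ret) (sym (+-identityʳ r)))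
... | no r+d≮ℓ = ⊥-elim (<-irrefl d≡ℓ d<ℓ)
  where
  ℓ≤r+d : ℓ ≤ r + d
  ℓ≤r+d = ≮⇒≥ r+d≮ℓ
  wrapped<ℓ : r + d ∸ ℓ < ℓ
  wrapped<ℓ = subst (r + d ∸ ℓ <_) (m+n∸n≡m ℓ ℓ) (∸-monoˡ-< (+-mono-< r<ℓ d<ℓ) ℓ≤r+d)
  wrapped≡r : r + d ∸ ℓ ≡ r
  wrapped≡r = trans (sym (m<n⇒m%n≡m wrapped<ℓ)) (trans (m≤n⇒[n∸m]%m≡n%m ℓ≤r+d) ret)
  d≡ℓ : d ≡ ℓ
  d≡ℓ = +-cancelˡ-≡ r d ℓ (begin
    r + d          ≡⟨ sym (m∸n+n≡m ℓ≤r+d) ⟩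
    r + d ∸ ℓ + ℓ  ≡⟨ cong (_+ ℓ) wrapped≡r ⟩
    r + ℓ          ∎)

%-window : ∀ ℓ .{{_ : NonZero ℓ}} p d → d < ℓ → (p + d) % ℓ ≡ p % ℓ → d ≡ 0
%-window ℓ p d d<ℓ ret = +-%-return (m%n<n p ℓ) d<ℓ (begin
  (p % ℓ + d) % ℓ      ≡⟨ cong (λ e → (p % ℓ + e) % ℓ) (sym (m<n⇒m%n≡m d<ℓ)) ⟩
  (p % ℓ + d % ℓ) % ℓ  ≡⟨ sym (%-distribˡ-+ p d ℓ) ⟩
  (p + d) % ℓ          ≡⟨ ret ⟩
  p % ℓ                ∎)

toℕ-next : ∀ {k} (i : Fin (suc k)) → toℕ (next i) ≡ suc (toℕ i) % suc k
toℕ-next i = toℕ-fromℕ< _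

next-below : ∀ {k} (i : Fin (suc k)) → toℕ i < k → toℕ (next i) ≡ suc (toℕ i)
next-below i i<k = trans (toℕ-next i) (m<n⇒m%n≡m (s≤s i<k))

next-top : ∀ {k} (i : Fin (suc k)) → toℕ i ≡ k → next i ≡ fzero
next-top {k} i i≡k = toℕ-injective (trans (toℕ-next i) (trans (cong (λ t → suc t % suc k) i≡k) (n%n≡0 (suc k))))

module Companion {n′ : ℕ} (A : Matrix (suc n′)) (companion : IsCompanion A) where

  n : ℕ
  n = suc n′

  last : Fin n
  last = fromℕ n′

  is-last : ∀ k → toℕ k ≡ n′ → k ≡ last
  is-last k k≡n′ = toℕ-injective (trans k≡n′ (sym (toℕ-fromℕ n′)))

  step-edge : ∀ i j → toℕ j ≡ suc (toℕ i) → Edge A i j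
  step-edge i j = proj₁ (companion i j)

  path-edge : (j : Fin n′) → Edge A (inject₁ j) (fsuc j)
  path-edge j = step-edge (inject₁ j) (fsuc j) (cong suc (sym (toℕ-inject₁ j)))

  -- All entries are 0 or 1, so positive entries are edges.
  positive⇒edge : ∀ i j → 0 < A i j → Edge A i j
  positive⇒edge i j p with toℕ j ≟ suc (toℕ i) | suc (toℕ i) ≟ n
  ... | yes up | _ = step-edge i j up
  ... | no _ | yes i-last with proj₁ (proj₂ (companion i j)) i-last
  ...   | inj₁ is-0 = ⊥-elim (<-irrefl (sym is-0) p)
  ...   | inj₂ is-1 = is-1
  positive⇒edge i j p | no ¬up | no ¬last = ⊥-elim (<-irrefl (sym (proj₂ (proj₂ (companion i j)) ¬up ¬last)) p)

  edge-shape : ∀ i j → Edge A i j → toℕ j ≡ suc (toℕ i) ⊎ toℕ i ≡ n′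
  edge-shape i j e with toℕ j ≟ suc (toℕ i) | suc (toℕ i) ≟ n
  ... | yes up | _ = inj₁ up
  ... | no _ | yes i-last = inj₂ (suc-injective i-last)
  ... | no ¬up | no ¬last = ⊥-elim (1+n≢0 (trans (sym e) (proj₂ (proj₂ (companion i j)) ¬up ¬last)))

  entered : Edge A last fzero → ∀ j → Σ (Fin n) λ k → 0 < A k j
  entered back fzero    = last , edge-pos A back
  entered back (fsuc j) = inject₁ j , edge-pos A (path-edge j)

  -- s is a back length if a back edge last → b has b + s = n: the path b → … → last
  -- closed by that edge is a cycle of length s.
  BackLength : ℕ → Set
  BackLength s = Σ (Fin n) λ b → Edge A last b × toℕ b + s ≡ n

  backLength≢0 : ¬ BackLength 0
  backLength≢0 (b , _ , b+0≡n) = <-irrefl (trans (sym (+-identityʳ _)) b+0≡n) (toℕ<n b)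

  climb : ∀ d {l i} (k j : Fin n) → toℕ k + d ≡ toℕ j → Walk A l i k → Walk A (l + d) i j
  climb zero {l} k j k+0≡j w rewrite +-identityʳ l | toℕ-injective (trans (sym (+-identityʳ (toℕ k))) k+0≡j) = w
  climb (suc d) k fzero k+d≡0 w = ⊥-elim (m+1+n≢0 (toℕ k) k+d≡0)
  climb (suc d) {l} k (fsuc j) k+d≡j w rewrite +-suc l d =
    walk-snoc (climb d k (inject₁ j) (trans (suc-injective (trans (sym (+-suc (toℕ k) d)) k+d≡j))
                                            (sym (toℕ-inject₁ j))) w)
              (edge-pos A (path-edge j))

  -- A back length s can be inserted into a walk as a loop last → b → … → last.
  loop : ∀ {s l i} → BackLength s → Walk A l i last → Walk A (l + s) i last
  loop {zero} B w = ⊥-elim (backLength≢0 B)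
  loop {suc s} {l} {i} (b , back , b+s≡n) w = subst (λ t → Walk A t i last) (sym (+-suc l s))
    (climb s b last (trans (suc-injective (trans (sym (+-suc (toℕ b) s)) b+s≡n)) (sym (toℕ-fromℕ n′)))
           (walk-snoc w (edge-pos A back)))

  loops : ∀ {x l i} → SumOf BackLength x → Walk A l i last → Walk A (l + x) i last
  loops {l = l} nil w rewrite +-identityʳ l = w
  loops {l = l} (cons {s} {m} B S) w rewrite sym (+-assoc l s m) = loops S (loop B w)

  closed-walk : Edge A last fzero → ∀ {x} → SumOf BackLength x → Walk A (n + x) fzero fzero
  closed-walk back S =
    walk-snoc (loops S (climb n′ fzero last (sym (toℕ-fromℕ n′)) walk-nil)) (edge-pos A back)

  -- The extra length m of a walk from 0 to j beyond the toℕ j path steps: either 0,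
  -- or the back length s of the latest back edge (which landed at or below j) plus a
  -- sum of earlier back lengths.
  Detour : Fin n → ℕ → Set
  Detour j m = m ≡ 0 ⊎
    Σ ℕ λ s → Σ ℕ λ m′ → m ≡ s + m′ × BackLength s × n ≤ toℕ j + s × SumOf BackLength m′

  detour-sum : ∀ {j m} → Detour j m → SumOf BackLength m
  detour-sum (inj₁ refl) = nil
  detour-sum (inj₂ (s , m′ , refl , B , _ , S)) = cons B S

  detour-up : ∀ {k j m} → toℕ j ≡ suc (toℕ k) → Detour k m → Detour j m
  detour-up up (inj₁ m≡0) = inj₁ m≡0
  detour-up {k} up (inj₂ (s , m′ , m≡s+m′ , B , n≤k+s , S)) =
    inj₂ (s , m′ , m≡s+m′ , B , ≤-trans n≤k+s (subst (λ t → toℕ k + s ≤ t + s) (sym up) (m≤n+m _ 1)) , S)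

  walk-shape : ∀ l j → Walk A l fzero j → Σ ℕ λ m → l ≡ toℕ j + m × Detour j m
  walk-shape zero j w = 0 , trans (walk-nil⁻ w) (sym (+-identityʳ _)) , inj₁ refl
  walk-shape (suc l) j w with walk-unsnoc w
  ... | k , wk , k→j with walk-shape l k wk | edge-shape k j (positive⇒edge k j k→j)
  ... | m , refl , d | inj₁ up = m , cong (_+ m) (sym up) , detour-up up d
  ... | m , refl , d | inj₂ top =
    s + m , length , inj₂ (s , m , refl , (j , back , j+s≡n) , ≤-reflexive (sym j+s≡n) , detour-sum d)
    where
    s : ℕ
    s = n ∸ toℕ j
    j+s≡n : toℕ j + s ≡ n
    j+s≡n = m+[n∸m]≡n (<⇒≤ (toℕ<n j))
    back : Edge A last j
    back = subst (λ x → Edge A x j) (is-last k top) (positive⇒edge k j k→j)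
    length : suc (toℕ k + m) ≡ toℕ j + (s + m)
    length = begin
      suc (toℕ k + m)  ≡⟨ cong (λ t → suc (t + m)) top ⟩
      n + m            ≡⟨ cong (_+ m) (sym j+s≡n) ⟩
      toℕ j + s + m    ≡⟨ +-assoc (toℕ j) s m ⟩
      toℕ j + (s + m)  ∎

  closed-walk-shape : ∀ {l} → 1 ≤ l → Walk A l fzero fzero →
    Edge A last fzero × Σ ℕ λ x → l ≡ n + x × SumOf BackLength x
  closed-walk-shape {l} 1≤l w with walk-shape l fzero w
  ... | m , refl , inj₁ refl = ⊥-elim (<-irrefl refl 1≤l)
  ... | m , refl , inj₂ (s , m′ , refl , (b , back , b+s≡n) , n≤s , S) =
    subst (Edge A last) b≡0 back , m′ , cong (_+ m′) s≡n , S
    where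
    s≡n : s ≡ n
    s≡n = ≤-antisym (subst (s ≤_) b+s≡n (m≤n+m s (toℕ b))) n≤s
    b≡0 : b ≡ fzero
    b≡0 = toℕ-injective (+-cancelʳ-≡ s (toℕ b) 0 (trans b+s≡n (sym s≡n)))

  closed-walk-length : ∀ l → 1 ≤ l → Walk A l fzero fzero → Σ ℕ λ x → l ≡ n + x
  closed-walk-length l 1≤l w with closed-walk-shape 1≤l w
  ... | _ , x , l≡n+x , _ = x , l≡n+x

  closed-walks : Edge A last fzero → ∀ x → Walk A (n + x) fzero fzero ⇔ SumOf BackLength x
  closed-walks back x = mk⇔ from-walk (closed-walk back)
    where
    from-walk : Walk A (n + x) fzero fzero → SumOf BackLength x
    from-walk w with closed-walk-shape (s≤s z≤n) w
    ... | _ , y , n+x≡n+y , S = subst (SumOf BackLength) (sym (+-cancelˡ-≡ n x y n+x≡n+y)) S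

  backLength⇒cycle : ∀ ℓ → BackLength ℓ → HasElemCycleOfLength A ℓ
  backLength⇒cycle zero B = ⊥-elim (backLength≢0 B)
  backLength⇒cycle (suc k) (b , back , b+ℓ≡n) = k , refl , v , v-injective , v-edges
    where
    fits : (i : Fin (suc k)) → toℕ b + toℕ i < n
    fits i = subst (toℕ b + toℕ i <_) b+ℓ≡n (+-monoʳ-< (toℕ b) (toℕ<n i))
    v : Fin (suc k) → Fin n
    v i = fromℕ< (fits i)
    toℕ-v : ∀ i → toℕ (v i) ≡ toℕ b + toℕ i
    toℕ-v i = toℕ-fromℕ< (fits i)
    v-injective : Injective _≡_ _≡_ v
    v-injective {i} {j} vi≡vj =
      toℕ-injective (+-cancelˡ-≡ (toℕ b) _ _ (trans (sym (toℕ-v i)) (trans (cong toℕ vi≡vj) (toℕ-v j))))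
    v-edges : ∀ i → Edge A (v i) (v (next i))
    v-edges i with m≤n⇒m<n∨m≡n (toℕ≤pred[n] i)
    ... | inj₁ i<k = step-edge (v i) (v (next i)) (begin
      toℕ (v (next i))      ≡⟨ toℕ-v (next i) ⟩
      toℕ b + toℕ (next i)  ≡⟨ cong (toℕ b +_) (next-below i i<k) ⟩
      toℕ b + suc (toℕ i)   ≡⟨ +-suc (toℕ b) (toℕ i) ⟩
      suc (toℕ b + toℕ i)   ≡⟨ cong suc (sym (toℕ-v i)) ⟩
      suc (toℕ (v i))       ∎)
    ... | inj₂ i≡k = subst₂ (Edge A) (sym vi≡last) (sym v-next≡b) back
      where
      vi≡last : v i ≡ last
      vi≡last = is-last (v i) (trans (toℕ-v i) (trans (cong (toℕ b +_) i≡k)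
                  (suc-injective (trans (sym (+-suc (toℕ b) k)) b+ℓ≡n))))
      v-next≡b : v (next i) ≡ b
      v-next≡b = toℕ-injective (trans (cong (λ x → toℕ (v x)) (next-top i i≡k)) (trans (toℕ-v fzero) (+-identityʳ _)))

  -- Going round an elementary cycle: it must visit last, and from the vertex b after
  -- last it climbs the path for a full round back to last, so b + ℓ = n.
  module CycleRound {k} (v : Fin (suc k) → Fin n) (v-injective : Injective _≡_ _≡_ v)
                    (v-edges : ∀ i → Edge A (v i) (v (next i))) where

    position : ℕ → Fin (suc k)
    position zero    = fzero
    position (suc t) = next (position t)

    toℕ-position : ∀ t → toℕ (position t) ≡ t % suc k
    toℕ-position zero    = refl
    toℕ-position (suc t) = trans (toℕ-next (position t))
      (trans (cong (λ r → suc r % suc k) (toℕ-position t)) (suc-% t (suc k)))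

    vertex : ℕ → Fin n
    vertex t = v (position t)

    height : ℕ → ℕ
    height t = toℕ (vertex t)

    periodic : ∀ t → vertex (t + suc k) ≡ vertex t
    periodic t = cong v (toℕ-injective (begin
      toℕ (position (t + suc k)) ≡⟨ toℕ-position (t + suc k) ⟩
      (t + suc k) % suc k        ≡⟨ [m+n]%n≡m%n t (suc k) ⟩
      t % suc k                  ≡⟨ sym (toℕ-position t) ⟩
      toℕ (position t)           ∎))

    no-early-return : ∀ t d → d < suc k → vertex (t + d) ≡ vertex t → d ≡ 0
    no-early-return t d d<ℓ returns = %-window (suc k) t d d<ℓ
      (trans (sym (toℕ-position (t + d))) (trans (cong toℕ (v-injective returns)) (toℕ-position t)))

    climb-or-top : ∀ t d → (Σ ℕ λ e → e < d × height (t + e) ≡ n′) ⊎ height (t + d) ≡ height t + d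
    climb-or-top t zero = inj₂ (trans (cong height (+-identityʳ t)) (sym (+-identityʳ _)))
    climb-or-top t (suc d) with climb-or-top t d
    ... | inj₁ (e , e<d , top) = inj₁ (e , m<n⇒m<1+n e<d , top)
    ... | inj₂ climbed with edge-shape _ _ (v-edges (position (t + d)))
    ...   | inj₂ top = inj₁ (d , n<1+n d , top)
    ...   | inj₁ up = inj₂ (begin
      height (t + suc d)   ≡⟨ cong height (+-suc t d) ⟩
      height (suc (t + d)) ≡⟨ up ⟩
      suc (height (t + d)) ≡⟨ cong suc climbed ⟩
      suc (height t + d)   ≡⟨ sym (+-suc (height t) d) ⟩
      height t + suc d     ∎)

    -- A cycle cannot climb all the way round, so it visits last.
    top-position : Σ ℕ λ p → height p ≡ n′
    top-position with climb-or-top 0 (suc k)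
    ... | inj₁ (p , _ , top) = p , top
    ... | inj₂ climbed = ⊥-elim (m+1+n≢m (height 0) (trans (sym climbed) (cong toℕ (periodic 0))))

    backLength : BackLength (suc k)
    backLength with top-position
    ... | p , top with climb-or-top (suc p) k
    ...   | inj₁ (e , e<k , top′) =
      ⊥-elim (1+n≢0 (no-early-return p (suc e) (s≤s e<k)
        (toℕ-injective (trans (cong height (+-suc p e)) (trans top′ (sym top))))))
    ...   | inj₂ climbed = vertex (suc p) , back , length
      where
      back : Edge A last (vertex (suc p))
      back = subst (λ x → Edge A x (vertex (suc p))) (is-last (vertex p) top) (v-edges (position p))
      length : height (suc p) + suc k ≡ n
      length = begin
        height (suc p) + suc k    ≡⟨ +-suc (height (suc p)) k ⟩
        suc (height (suc p) + k)  ≡⟨ cong suc (sym climbed) ⟩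
        suc (height (suc p + k))  ≡⟨ cong (λ t → suc (height t)) (sym (+-suc p k)) ⟩
        suc (height (p + suc k))  ≡⟨ cong (λ x → suc (toℕ x)) (periodic p) ⟩
        suc (height p)            ≡⟨ cong suc top ⟩
        n                         ∎

  cycle⇒backLength : ∀ ℓ → HasElemCycleOfLength A ℓ → BackLength ℓ
  cycle⇒backLength ℓ (k , refl , v , v-injective , v-edges) = CycleRound.backLength v v-injective v-edges

  backLength⇔cycle : ∀ ℓ → BackLength ℓ ⇔ HasElemCycleOfLength A ℓ
  backLength⇔cycle ℓ = mk⇔ (backLength⇒cycle ℓ) (cycle⇒backLength ℓ)

mainTheorem6 : (n : ℕ) (2≤n : 2 ≤ n) (A : Matrix n) →
    IsCompanion A → IsPrimitive A → trace A ≡ 0 →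
    (ls : List ℕ) → Linked _<_ ls → (∀ ℓ → (ℓ ∈ ls) ⇔ HasElemCycleOfLength A ℓ) →
    Σ ℕ λ N → IsFrobeniusF ls N × IsLocalExp A (vertex1 2≤n) (vertex1 2≤n) (n + N)
mainTheorem6 (suc n′) _ A companion (m , 1≤m , positive-power) _ ls _ cycles =
  N , threshold , s≤s z≤n ,
  shift-threshold (λ l 1≤l p → closed-walk-length l 1≤l (walk p)) positive⇔representable threshold
  where
  open Companion A companion

  -- a primitive A has a closed walk at 0, hence the back edge last → 0
  back : Edge A last fzero
  back = proj₁ (closed-walk-shape 1≤m (walk (positive-power fzero fzero)))

  -- (A^(n+x))_00 > 0 iff x is a sum of back lengths, i.e. of cycle lengths, i.e. of members of ls
  positive⇔representable : ∀ x → 0 < pow A (n + x) fzero fzero ⇔ Representable ls x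
  positive⇔representable x =
    ⇔-sym (representable⇔sumOf ls)
      ⇔-∘ (sumOf-⇔ (λ s → ⇔-sym (cycles s) ⇔-∘ backLength⇔cycle s)
      ⇔-∘ (closed-walks back x ⇔-∘ ⇔-sym walk⇔positive))

  -- by primitivity all closed walks at 0 of length at least m exist
  long-representable : ∀ x → m ≤ x → Representable ls x
  long-representable x m≤x = Equivalence.to (positive⇔representable x) (Walk.positive
    (positive-row-persists (entered back) (λ j → walk (positive-power fzero j))
                           (n + x) (≤-trans m≤x (m≤n+m x n)) fzero))

  -- representability of x is decided by computing (A^(n+x))_00
  representable? : ∀ x → Dec (Representable ls x)
  representable? x = map′ to from (0 <? pow A (n + x) fzero fzero)
    where open Equivalence (positive⇔representable x)

  frobenius : Σ ℕ (IsThreshold (Representable ls))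
  frobenius = least-threshold representable? m long-representable

  N : ℕ
  N = proj₁ frobenius

  threshold : IsThreshold (Representable ls) N
  threshold = proj₂ frobenius
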